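{- Let $\mathcal{A}$ be an alphabet. Let $\underline{\mathsf{Plac}}'(\mathcal{A})$ be the category defined exactly as $\underline{\mathsf{Plac}}(\mathcal{A})$ except that condition (2) requires that $\phi(\widehat{\mathcal{S}}_{(1)})$ and $\phi(\widehat{\mathcal{S}}_{(2)})$ commute in $\mathbb{Z}\mathbf{M}$ (instead of $\phi(\widehat{\mathcal{S}}_{(1)})$ and $\phi(\widehat{\mathcal{S}}_{(1,1)})$). Then $\underline{\mathsf{Plac}}'(\mathcal{A})=\underline{\mathsf{Plac}}(\mathcal{A})$. In particular, $({\mathbf{P}}(\mathcal{A}),\kappa,\lambda)$ is the initial object of both.
   Context: An alphabet is a totally ordered set. A morphism of alphabets $f:\mathcal{B}\to\mathcal{C}$ is a strictly order-preserving map; it induces a monoid morphism $\mathbf{F}(f):\mathbf{F}(\mathcal{B})\to\mathbf{F}(\mathcal{C})$ of free monoids (letterwise), called an ordered morphism. $\mathbf{F}(\mathcal{A})$ is the free monoid on $\mathcal{A}$, $\mathbf{C}(\mathcal{A})$ the free commutative monoid on $\mathcal{A}$, and $\epsilon:\mathbf{F}(\mathcal{A})\to\mathbf{C}(\mathcal{A})$ the abelianization map. A subset $I\subseteq\mathcal{A}$ is an interval if $i<k<j$ with $i,j\in I$, $k\in\mathcal{A}$ implies $k\in I$; $\rho_I:\mathbf{F}(\mathcal{A})\to\mathbf{F}(I)\subseteq\mathbf{F}(\mathcal{A})$ deletes all letters not in $I$. The plactic monoid ${\mathbf{P}}(\mathcal{A})$ is the quotient of $\mathbf{F}(\mathcal{A})$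 by the Knuth relations $acb\sim cab$ for all $a\le b<c$ and $bca\sim bac$ for all $a<b\le c$; $\kappa$ is the quotient map and $\lambda:{\mathbf{P}}(\mathcal{A})\to\mathbf{C}(\mathcal{A})$ the abelianization map. For a monoid $\mathbf{M}$ that is a quotient of $\mathbf{F}(\mathcal{A})$ by homogeneous relations, $\mathbb{Z}\mathbf{M}$ denotes the graded inverse limit of the monoid algebras $\mathbb{Z}\mathbf{M}(\mathcal{B})$ over finite subalphabets $\mathcal{B}\subseteq\mathcal{A}$, where $\mathbf{M}(\mathcal{B})$ is the image of $\mathbf{F}(\mathcal{B})$; a surjection $\phi:\mathbf{F}(\mathcal{A})\to\mathbf{M}$ extends linearly to $\mathbb{Z}\mathbf{F}(\mathcal{A})\to\mathbb{Z}\mathbf{M}$. Free Schur functions: for a partition $\nu$ of length $\ell$, $\widehat{\mathcal{S}}_\nu\in\mathbb{Z}\mathbf{F}(\mathcal{A})$ is the sum of all words $w=w_1\cdots w_\ell$ that are concatenations of weakly increasing segments $w_i$ of length $\nu_{\ell+1-i}$ such that for every $i>1$, $w_i$ is a longest weakly increasing subword of $w_{i-1}w_i$. In particular $\widehat{\mathcal{S}}_{(1)}=\sum_{a\in\mathcal{A}}a$, $\widehat{\mathcal{S}}_{(1,1)}=\sum_{a<b}ba$, and $\widehat{\mathcal{S}}_{(2)}=\sum_{a\le b}ab$. The category $\underline{\mathsf{Plac}}(\mathcal{A})$ has as objects triples $(\mathbf{M},\phi,\psi)$ with $\mathbf{M}$ a monoid, $\phi:\mathbf{F}(\mathcal{A})\to\mathbf{M}$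 a surjective monoid morphism and $\psi:\mathbf{M}\to\mathbf{C}(\mathcal{A})$ a monoid morphism such that: (1) $\psi\circ\phi=\epsilon$; (2) $\phi(\widehat{\mathcal{S}}_{(1)})$ and $\phi(\widehat{\mathcal{S}}_{(1,1)})$ commute in $\mathbb{Z}\mathbf{M}$; (3) for any finite subalphabets $\mathcal{B},\mathcal{C}\subseteq\mathcal{A}$, any ordered morphism $\omega:\mathbf{F}(\mathcal{B})\to\mathbf{F}(\mathcal{C})$ and any $w_1,w_2\in\mathbf{F}(\mathcal{B})$, if $\phi(w_1)=\phi(w_2)$ then $\phi(\omega(w_1))=\phi(\omega(w_2))$; (4) for any interval $I\subseteq\mathcal{A}$ and any $w_1,w_2\in\mathbf{F}(\mathcal{A})$, if $\phi(w_1)=\phi(w_2)$ then $\phi(\rho_I(w_1))=\phi(\rho_I(w_2))$. A morphism $(\mathbf{M}',\phi',\psi')\to(\mathbf{M},\phi,\psi)$ is a monoid morphism $\theta:\mathbf{M}'\to\mathbf{M}$ with $\theta\circ\phi'=\phi$ and $\psi\circ\theta=\psi'$. -}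

module Defs where

open import Level using (Level; _⊔_; suc; Setω)
open import Data.Product using (Σ; _×_; _,_; proj₁; proj₂; ∃)
open import Data.Sum using (_⊎_; inj₁; inj₂)
open import Data.List using (List; []; _∷_; [_]; _++_; map; filter; cartesianProduct; cartesianProductWith)
open import Data.List.Properties using (++-assoc; ++-identityʳ)
open import Data.List.Membership.Propositional using (_∈_)
open import Data.List.Relation.Unary.All using (All)
open import Data.List.Relation.Unary.Unique.Propositional using (Unique)
open import Data.List.Relation.Binary.Permutation.Propositional
  using (_↭_; ↭-refl; ↭-sym; ↭-trans; swap)
open import Data.List.Relation.Binary.Permutation.Propositional.Properties using (++⁺)
import Data.List.Relation.Binary.Permutation.Setoid as SPerm
open import Relation.Nullary using (Dec; yes; no)
open import Relation.Nullary.Decidable using (_⊎-dec_)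
open import Relation.Unary using (Pred; Decidable)
open import Relation.Binary using (Rel; IsStrictTotalOrder)
open import Relation.Binary.PropositionalEquality using (_≡_; refl)
open import Algebra.Bundles using (Monoid)

record _×ω_ (P Q : Setω) : Setω where
  constructor _,ω_
  field
    fst : P
    snd : Q

module Alph {a r : Level} {A : Set a} {_<_ : Rel A r}
            (sto : IsStrictTotalOrder _≡_ _<_) where

  open IsStrictTotalOrder sto using (_<?_; _≟_)

  Word : Set a
  Word = List A

  -- The free commutative monoid C(A) is represented as words modulo
  -- permutation (_↭_); the abelianization ε is then the identity.

  _≤_ : A → A → Set (a ⊔ r)
  x ≤ y = (x < y) ⊎ (x ≡ y)

  _≤?_ : (x y : A) → Dec (x ≤ y)
  x ≤? y = (x <? y) ⊎-dec (x ≟ y)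

  record Presentation (c ℓ : Level) : Set (suc (c ⊔ ℓ) ⊔ a) where
    field
      M      : Monoid c ℓ
    open Monoid M public
    field
      φ      : Word → Carrier
      φ-ε    : φ [] ≈ ε
      φ-∙    : ∀ u v → φ (u ++ v) ≈ φ u ∙ φ v
      φ-surj : ∀ m → Σ Word (λ w → φ w ≈ m)
      ψ      : Carrier → Word
      ψ-cong : ∀ {x y} → x ≈ y → ψ x ↭ ψ y
      ψ-ε    : ψ ε ↭ []
      ψ-∙    : ∀ x y → ψ (x ∙ y) ↭ (ψ x ++ ψ y)

  -- Finite formal sums of words (elements of ℕF(B) ⊆ ℤF(A) with
  -- nonnegative coefficients), given as lists of words.

  mult : List Word → List Word → List Word
  mult = cartesianProductWith _++_

  S1 : List A → List Word
  S1 B = map [_] B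

  S11 : List A → List Word
  S11 B = map (λ p → proj₂ p ∷ proj₁ p ∷ [])
              (filter (λ p → proj₁ p <? proj₂ p) (cartesianProduct B B))

  S2 : List A → List Word
  S2 B = map (λ p → proj₁ p ∷ proj₂ p ∷ [])
             (filter (λ p → proj₁ p ≤? proj₂ p) (cartesianProduct B B))

  IsInterval : ∀ {ℓI} → Pred A ℓI → Set (a ⊔ r ⊔ ℓI)
  IsInterval I = ∀ {i k j} → I i → I j → i < k → k < j → I k

  module _ {c ℓ} (X : Presentation c ℓ) where
    open Presentation X

    -- Two nonnegative finite formal sums of words have equal images in
    -- ℤM(B) iff the lists of their images in M are permutations of each
    -- other w.r.t. the equality of M.
    _≈ℤM_ : List Word → List Word → Set (c ⊔ ℓ)
    xs ≈ℤM ys = SPerm._↭_ setoid (map φ xs) (map φ ys)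

    -- φ(F) and φ(G) commute in ℤM : their projections commute in ℤM(B)
    -- for every finite subalphabet B.
    Commute : (List A → List Word) → (List A → List Word) → Set (a ⊔ c ⊔ ℓ)
    Commute F G = ∀ (B : List A) → Unique B → mult (F B) (G B) ≈ℤM mult (G B) (F B)

    Cond1 : Set a
    Cond1 = ∀ w → ψ (φ w) ↭ w

    Cond2 : Set (a ⊔ c ⊔ ℓ)
    Cond2 = Commute S1 S11

    Cond2' : Set (a ⊔ c ⊔ ℓ)
    Cond2' = Commute S1 S2

    -- Ordered morphisms between finite subalphabets B, C: given by a map
    -- f : A → A that sends B into C and is strictly order preserving on B.
    Cond3 : Set (a ⊔ r ⊔ ℓ)
    Cond3 = ∀ (B C : List A) → Unique B → Unique C → (f : A → A) →
            (∀ {x} → x ∈ B → f x ∈ C) →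
            (∀ {x y} → x ∈ B → y ∈ B → x < y → f x < f y) →
            ∀ (w₁ w₂ : Word) → All (_∈ B) w₁ → All (_∈ B) w₂ →
            φ w₁ ≈ φ w₂ → φ (map f w₁) ≈ φ (map f w₂)

    -- ρ_I = filter by (decidable) membership in the interval I.
    Cond4 : Set (suc a ⊔ r ⊔ ℓ)
    Cond4 = ∀ (I : Pred A a) (I? : Decidable I) → IsInterval I →
            ∀ (w₁ w₂ : Word) → φ w₁ ≈ φ w₂ → φ (filter I? w₁) ≈ φ (filter I? w₂)

    IsPlac : Set (suc a ⊔ r ⊔ c ⊔ ℓ)
    IsPlac = Cond1 × Cond2 × Cond3 × Cond4

    IsPlac' : Set (suc a ⊔ r ⊔ c ⊔ ℓ)
    IsPlac' = Cond1 × Cond2' × Cond3 × Cond4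

  record Hom {c ℓ c' ℓ'} (X : Presentation c ℓ) (Y : Presentation c' ℓ')
         : Set (a ⊔ c ⊔ ℓ ⊔ c' ⊔ ℓ') where
    private
      module X = Presentation X
      module Y = Presentation Y
    field
      θ      : X.Carrier → Y.Carrier
      θ-cong : ∀ {m n} → m X.≈ n → θ m Y.≈ θ n
      θ-ε    : θ X.ε Y.≈ Y.ε
      θ-∙    : ∀ m n → θ (m X.∙ n) Y.≈ (θ m Y.∙ θ n)
      θ-φ    : ∀ w → θ (X.φ w) Y.≈ Y.φ w
      θ-ψ    : ∀ m → Y.ψ (θ m) ↭ X.ψ m

  data Variant : Set where
    plac plac' : Variant

  IsObj : Variant → ∀ {c ℓ} → Presentation c ℓ → Set (suc a ⊔ r ⊔ c ⊔ ℓ)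
  IsObj plac  X = IsPlac X
  IsObj plac' X = IsPlac' X

  record IsInitial (v : Variant) {c ℓ} (X : Presentation c ℓ) : Setω where
    field
      isObj  : IsObj v X
      arrow  : ∀ {c' ℓ'} (Y : Presentation c' ℓ') → IsObj v Y → Hom X Y
      unique : ∀ {c' ℓ'} (Y : Presentation c' ℓ') → IsObj v Y →
               (h h' : Hom X Y) → ∀ m →
               Presentation._≈_ Y (Hom.θ h m) (Hom.θ h' m)

  infix 4 _∼_
  data _∼_ : Word → Word → Set (a ⊔ r) where
    ∼-refl  : ∀ {u} → u ∼ u
    ∼-sym   : ∀ {u v} → u ∼ v → v ∼ u
    ∼-trans : ∀ {u v w} → u ∼ v → v ∼ w → u ∼ w
    ∼-cong  : ∀ {u u' v v'} → u ∼ u' → v ∼ v' → u ++ v ∼ u' ++ v'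
    knuth₁  : ∀ {x y z} → x ≤ y → y < z → x ∷ z ∷ y ∷ [] ∼ z ∷ x ∷ y ∷ []
    knuth₂  : ∀ {x y z} → x < y → y ≤ z → y ∷ z ∷ x ∷ [] ∼ y ∷ x ∷ z ∷ []

  ∼⇒↭ : ∀ {u v} → u ∼ v → u ↭ v
  ∼⇒↭ ∼-refl = ↭-refl
  ∼⇒↭ (∼-sym p) = ↭-sym (∼⇒↭ p)
  ∼⇒↭ (∼-trans p q) = ↭-trans (∼⇒↭ p) (∼⇒↭ q)
  ∼⇒↭ (∼-cong p q) = ++⁺ (∼⇒↭ p) (∼⇒↭ q)
  ∼⇒↭ (knuth₁ _ _) = swap _ _ ↭-refl
  ∼⇒↭ (knuth₂ _ _) = _↭_.prep _ (swap _ _ ↭-refl)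

  ≡⇒∼ : ∀ {u v} → u ≡ v → u ∼ v
  ≡⇒∼ refl = ∼-refl

  PlacMonoid : Monoid a (a ⊔ r)
  PlacMonoid = record
    { Carrier = Word
    ; _≈_ = _∼_
    ; _∙_ = _++_
    ; ε = []
    ; isMonoid = record
      { isSemigroup = record
        { isMagma = record
          { isEquivalence = record { refl = ∼-refl ; sym = ∼-sym ; trans = ∼-trans }
          ; ∙-cong = ∼-cong }
        ; assoc = λ x y z → ≡⇒∼ (++-assoc x y z) }
      ; identity = (λ _ → ∼-refl) , (λ x → ≡⇒∼ (++-identityʳ x)) } }

  Plactic : Presentation a (a ⊔ r)
  Plactic = record
    { M = PlacMonoid
    ; φ = λ w → w
    ; φ-ε = ∼-refl
    ; φ-∙ = λ _ _ → ∼-refl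
    ; φ-surj = λ m → m , ∼-refl
    ; ψ = λ w → w
    ; ψ-cong = ∼⇒↭
    ; ψ-ε = ↭-refl
    ; ψ-∙ = λ _ _ → ↭-refl }

{-# OPTIONS --safe #-}
module Submission where

-- First, in the plactic monoid S₁ commutes with S₁₁ and with S₂:
-- sending a term x·vu of S₁S₁₁ (resp. x·uv of S₁S₂) to the term of S₁₁S₁ (resp. S₂S₁) obtained
-- by moving x across the column (resp. row) with at most one Knuth relation is a bijection.
-- Hence every presentation whose φ respects the Knuth relations satisfies both versions of (2);
-- in particular the plactic monoid, which also satisfies (1), (3) and (4), lies in both
-- categories.
-- Conversely, φ respects the Knuth relations as soon as (1), (3), (4) and either version of (2)
-- hold. For letters a < b < c (or a < b), the commutation in ℤM({a, b, c}) matches the left side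
-- of a Knuth relation with a term of the other product having the same image, hence by (1) the
-- same content. Either that term is the Knuth partner, or restricting both words to a two-letter
-- interval by (4) gives φ(xy) = φ(yx) for some x < y; by (3) this holds for all pairs, so φ
-- identifies all permutations, Knuth partners included. Thus φ factors through P(A), which makes
-- (P(A), κ, λ) initial in both categories.

open import Defs
open import Level using (Level; _⊔_; Lift; lift; lower)
open import Function using (id; _∘_; _⇔_; mk⇔; Equivalence)
open import Data.Bool using (_∧_; if_then_else_; true; false)
import Data.Nat as ℕ
open import Data.Fin using (Fin)
import Data.Fin as Fin
open import Data.Fin.Patterns using (0F; 1F; 2F)
import Data.Fin.Properties as Fin
open import Data.Product using (_×_; _,_; proj₁; proj₂)
import Data.Product as Product
open import Data.Sum using (inj₁; inj₂)
import Data.Sum as Sum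
open import Data.List
  using (List; []; _∷_; [_]; _++_; map; filter; length; allFin; cartesianProduct; cartesianProductWith)
open import Data.List.Properties
  using ( map-∘; map-cong; map-++; length-map; filter-++; filter-reject; filter-all; ++-assoc
        ; ∷-injective; ∷ʳ-injective; ≡-dec)
open import Data.List.Membership.Propositional using (_∈_)
open import Data.List.Membership.Propositional.Properties
  using (∈-map⁻; ∈-map⁺; ∈-filter⁻; ∈-filter⁺; ∈-cartesianProduct⁻; ∈-cartesianProduct⁺)
open import Data.List.Membership.Propositional.Properties.WithK using (unique∧set⇒bag)
import Data.List.Membership.DecPropositional as DecMembership
open import Data.List.Relation.Unary.Any using (Any; here; there)
import Data.List.Relation.Unary.Any as Any
import Data.List.Relation.Unary.Any.Properties as Any
open import Data.List.Relation.Unary.All using (All; all?; []; _∷_)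
import Data.List.Relation.Unary.All as All
import Data.List.Relation.Unary.All.Properties as All
open import Data.List.Relation.Unary.AllPairs using ([]; _∷_)
open import Data.List.Relation.Unary.Unique.Propositional using (Unique)
import Data.List.Relation.Unary.Unique.Propositional.Properties as Unique
open import Data.List.Relation.Binary.Pointwise using ([]; _∷_)
open import Data.List.Relation.Binary.BagAndSetEquality using (∼bag⇒↭)
open import Data.List.Relation.Binary.Permutation.Propositional
  using (_↭_; ↭-refl; ↭-sym; ↭-trans; prep; swap; ↭⇒↭ₛ′)
import Data.List.Relation.Binary.Permutation.Propositional as ↭
open import Data.List.Relation.Binary.Permutation.Propositional.Properties
  using (All-resp-↭; ↭-length; filter-↭)
import Data.List.Relation.Binary.Permutation.Setoid as SetoidPermutation
import Data.List.Relation.Binary.Permutation.Setoid.Properties as SetoidPermutationProperties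
import Data.List.Relation.Binary.Equality.Setoid as SetoidEquality
open import Algebra.Bundles using (Monoid)
open import Relation.Binary
  using (Rel; Setoid; IsStrictTotalOrder; tri<; tri≈; tri>) renaming (Decidable to Decidable₂)
open import Relation.Nullary using (¬_; yes; no; does; contradiction)
open import Relation.Nullary.Decidable
  using (True; toWitness; fromWitness; map′; T?; _×-dec_; dec-true; dec-false; does-⇔; isYes; isYes≗does)
open import Relation.Unary using (Pred; Decidable)
open import Relation.Binary.PropositionalEquality as ≡
  using (_≡_; _≢_; refl; sym; trans; cong; cong₂; subst; subst₂; module ≡-Reasoning)

private variable
  a b c d e e′ : Level
  A : Set a
  B : Set b

filter-map : ∀ {p q} {P : Pred B p} {Q : Pred A q} (P? : Decidable P) (Q? : Decidable Q) {f : A → B} →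
             (∀ x → does (P? (f x)) ≡ does (Q? x)) → ∀ xs → filter P? (map f xs) ≡ map f (filter Q? xs)
filter-map P? Q? agree [] = refl
filter-map P? Q? {f} agree (x ∷ xs) rewrite agree x with does (Q? x)
... | true  = cong (f x ∷_) (filter-map P? Q? agree xs)
... | false = filter-map P? Q? agree xs

cartesianProductWith-map : ∀ {A′ : Set c} {B′ : Set d} {C : Set e} {C′ : Set e′}
  (h : A → B → C) (h′ : A′ → B′ → C′) {f : A′ → A} {g : B′ → B} {k : C′ → C} →
  (∀ x y → h (f x) (g y) ≡ k (h′ x y)) →
  ∀ xs ys → cartesianProductWith h (map f xs) (map g ys) ≡ map k (cartesianProductWith h′ xs ys)
cartesianProductWith-map _ _ _ [] _ = refl
cartesianProductWith-map h h′ {f} {g} {k} natural (x ∷ xs) ys = begin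
  map (h (f x)) (map g ys) ++ cartesianProductWith h (map f xs) (map g ys)
    ≡⟨ cong₂ _++_ first-block (cartesianProductWith-map h h′ natural xs ys) ⟩
  map k (map (h′ x) ys) ++ map k (cartesianProductWith h′ xs ys)
    ≡⟨ map-++ k (map (h′ x) ys) _ ⟨
  map k (map (h′ x) ys ++ cartesianProductWith h′ xs ys) ∎
  where
  open ≡-Reasoning
  first-block : map (h (f x)) (map g ys) ≡ map k (map (h′ x) ys)
  first-block = trans (sym (map-∘ ys)) (trans (map-cong (natural x) ys) (map-∘ ys))

module _ {p} {P : Pred A p} (P? : Decidable P) {x : A} (¬Px : ¬ P x) where

  filter-drop : ∀ u v → filter P? (u ++ x ∷ v) ≡ filter P? (u ++ v)
  filter-drop u v = begin
    filter P? (u ++ x ∷ v)           ≡⟨ filter-++ P? u (x ∷ v) ⟩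
    filter P? u ++ filter P? (x ∷ v) ≡⟨ cong (filter P? u ++_) (filter-reject P? ¬Px) ⟩
    filter P? u ++ filter P? v       ≡⟨ filter-++ P? u v ⟨
    filter P? (u ++ v)               ∎
    where open ≡-Reasoning

  filter-swap-dropped : ∀ {y} u v → filter P? (u ++ x ∷ y ∷ v) ≡ filter P? (u ++ y ∷ x ∷ v)
  filter-swap-dropped {y} u v = begin
    filter P? (u ++ x ∷ y ∷ v)        ≡⟨ filter-drop u (y ∷ v) ⟩
    filter P? (u ++ y ∷ v)            ≡⟨ cong (filter P?) (++-assoc u [ y ] v) ⟨
    filter P? ((u ++ [ y ]) ++ v)     ≡⟨ filter-drop (u ++ [ y ]) v ⟨
    filter P? ((u ++ [ y ]) ++ x ∷ v) ≡⟨ cong (filter P?) (++-assoc u [ y ] (x ∷ v)) ⟩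
    filter P? (u ++ y ∷ x ∷ v)        ∎
    where open ≡-Reasoning

Unique-map⁺-local : ∀ {f : A → B} {xs} → (∀ {x y} → x ∈ xs → y ∈ xs → f x ≡ f y → x ≡ y) →
                    Unique xs → Unique (map f xs)
Unique-map⁺-local {xs = []}     _   []          = []
Unique-map⁺-local {xs = x ∷ xs} inj (x∉xs ∷ xs!) =
  All.map⁺ (All.tabulate λ y∈xs fx≡fy → All.lookup x∉xs y∈xs (inj (here refl) (there y∈xs) fx≡fy))
  ∷ Unique-map⁺-local (λ y∈xs z∈xs → inj (there y∈xs) (there z∈xs)) xs!

module _ (S : Setoid c e) where
  open Setoid S using (Carrier; _≈_)
  open SetoidPermutation S using (↭-reflexive-≋) renaming (_↭_ to _↭ₛ_; ↭-trans to ↭ₛ-trans)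
  open SetoidEquality S using (_≋_)

  ≋-map-self : ∀ {g : Carrier → Carrier} {zs} → (∀ {z} → z ∈ zs → z ≈ g z) → zs ≋ map g zs
  ≋-map-self {zs = []}     _   = []
  ≋-map-self {zs = z ∷ zs} z≈g = z≈g (here refl) ∷ ≋-map-self (z≈g ∘ there)

  ↭-of-bijection : ∀ {L R : List Carrier} (g g⁻¹ : Carrier → Carrier) → Unique L → Unique R →
    (∀ {z} → z ∈ L → g z ∈ R) → (∀ {z} → z ∈ R → g⁻¹ z ∈ L) →
    (∀ {z} → z ∈ L → g⁻¹ (g z) ≡ z) → (∀ {z} → z ∈ R → g (g⁻¹ z) ≡ z) →
    (∀ {z} → z ∈ L → z ≈ g z) → L ↭ₛ R
  ↭-of-bijection {L} {R} g g⁻¹ L! R! g∈R g⁻¹∈L g⁻¹∘g g∘g⁻¹ z≈g =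
    ↭ₛ-trans (↭-reflexive-≋ (≋-map-self z≈g)) (↭⇒↭ₛ′ (Setoid.isEquivalence S) gL↭R)
    where
    g-injective : ∀ {y z} → y ∈ L → z ∈ L → g y ≡ g z → y ≡ z
    g-injective y∈L z∈L gy≡gz = trans (sym (g⁻¹∘g y∈L)) (trans (cong g⁻¹ gy≡gz) (g⁻¹∘g z∈L))
    same-elements : ∀ {z} → z ∈ map g L ⇔ z ∈ R
    same-elements = mk⇔ to from
      where
      to : ∀ {z} → z ∈ map g L → z ∈ R
      to z∈gL with _ , y∈L , refl ← ∈-map⁻ g z∈gL = g∈R y∈L
      from : ∀ {z} → z ∈ R → z ∈ map g L
      from z∈R = subst (_∈ map g L) (g∘g⁻¹ z∈R) (∈-map⁺ g (g⁻¹∈L z∈R))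
    gL↭R : map g L ↭ R
    gL↭R = ∼bag⇒↭ (unique∧set⇒bag (Unique-map⁺-local g-injective L!) R! same-elements)

module Alphabet {a r} {A : Set a} {_<_ : Rel A r} (sto : IsStrictTotalOrder _≡_ _<_) where
  open Alph sto
  open IsStrictTotalOrder sto using (compare; _<?_; asym) renaming (trans to <-trans; irrefl to <-irrefl)

  private variable
    x y z : A

  <⇒≢ : x < y → x ≢ y
  <⇒≢ x<y refl = <-irrefl refl x<y

  ≤-<-trans : x ≤ y → y < z → x < z
  ≤-<-trans (inj₁ x<y)  y<z = <-trans x<y y<z
  ≤-<-trans (inj₂ refl) y<z = y<z

  <-≤-trans : x < y → y ≤ z → x < z
  <-≤-trans x<y (inj₁ y<z)  = <-trans x<y y<z
  <-≤-trans x<y (inj₂ refl) = x<y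

  ≤-trans : x ≤ y → y ≤ z → x ≤ z
  ≤-trans (inj₁ x<y)  y≤z = inj₁ (<-≤-trans x<y y≤z)
  ≤-trans (inj₂ refl) y≤z = y≤z

  ≤⇒≯ : x ≤ y → ¬ y < x
  ≤⇒≯ (inj₁ x<y)  y<x = asym x<y y<x
  ≤⇒≯ (inj₂ refl) y<x = <-irrefl refl y<x

  ≮⇒≥ : ¬ x < y → y ≤ x
  ≮⇒≥ {x} {y} x≮y with compare x y
  ... | tri< x<y _ _ = contradiction x<y x≮y
  ... | tri≈ _ x≡y _ = inj₂ (sym x≡y)
  ... | tri> _ _ y<x = inj₁ y<x

  data ≤-Placement (x u v : A) : Set (a ⊔ r) where
    below   : x ≤ u → ≤-Placement x u v
    between : u < x → x ≤ v → ≤-Placement x u v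
    above   : u < x → v < x → ≤-Placement x u v

  ≤-placement : ∀ x u v → ≤-Placement x u v
  ≤-placement x u v with u <? x | v <? x
  ... | no u≮x  | _       = below (≮⇒≥ u≮x)
  ... | yes u<x | no v≮x  = between u<x (≮⇒≥ v≮x)
  ... | yes u<x | yes v<x = above u<x v<x

  data <-Placement (x u v : A) : Set (a ⊔ r) where
    below   : x < u → <-Placement x u v
    between : u ≤ x → x < v → <-Placement x u v
    above   : u ≤ x → v ≤ x → <-Placement x u v

  <-placement : ∀ x u v → <-Placement x u v
  <-placement x u v with x <? u | x <? v
  ... | yes x<u | _       = below x<u
  ... | no x≮u  | yes x<v = between (≮⇒≥ x≮u) x<v
  ... | no x≮u  | no x≮v  = above (≮⇒≥ x≮u) (≮⇒≥ x≮v)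

  -- Membership is boolean so that the predicate lives in Pred A a, as condition (4) requires.
  Between : A → A → Pred A a
  Between lo hi t = Lift a (True (lo ≤? t) × True (t ≤? hi))

  Between? : ∀ lo hi → Decidable (Between lo hi)
  Between? lo hi t = map′ lift lower (T? _ ×-dec T? _)

  Between-isInterval : ∀ {lo hi} → IsInterval (Between lo hi)
  Between-isInterval (lift (lo≤i , _)) (lift (_ , j≤hi)) i<k k<j =
    lift ( fromWitness (inj₁ (≤-<-trans (toWitness lo≤i) i<k))
         , fromWitness (inj₁ (<-≤-trans k<j (toWitness j≤hi))) )

module PlacticCongruence {a r} {A : Set a} {_<_ : Rel A r} (sto : IsStrictTotalOrder _≡_ _<_) where
  open Alph sto
  open Alphabet sto using (≤-<-trans; <-≤-trans)

  private variable
    x y z : A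
    u v : Word

  ∼-resp-All : ∀ {p} {P : Pred A p} → u ∼ v → All P u → All P v
  ∼-resp-All u∼v = All-resp-↭ (∼⇒↭ u∼v)

  module _ {B : List A} {f : A → A} (f-mono : ∀ {x y} → x ∈ B → y ∈ B → x < y → f x < f y) where

    private
      f-mono-≤ : x ∈ B → y ∈ B → x ≤ y → f x ≤ f y
      f-mono-≤ x∈B y∈B (inj₁ x<y)  = inj₁ (f-mono x∈B y∈B x<y)
      f-mono-≤ x∈B y∈B (inj₂ refl) = inj₂ refl

    ∼-map : u ∼ v → All (_∈ B) u → map f u ∼ map f v
    ∼-map ∼-refl        _  = ∼-refl
    ∼-map (∼-sym v∼u)   ⊆B = ∼-sym (∼-map v∼u (∼-resp-All (∼-sym v∼u) ⊆B))
    ∼-map (∼-trans u∼w w∼v) ⊆B = ∼-trans (∼-map u∼w ⊆B) (∼-map w∼v (∼-resp-All u∼w ⊆B))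
    ∼-map (∼-cong {u} {u′} {v} {v′} u∼u′ v∼v′) ⊆B =
      ∼-trans (≡⇒∼ (map-++ f u v))
        (∼-trans (∼-cong (∼-map u∼u′ (All.++⁻ˡ u ⊆B)) (∼-map v∼v′ (All.++⁻ʳ u ⊆B)))
          (≡⇒∼ (sym (map-++ f u′ v′))))
    ∼-map (knuth₁ x≤y y<z) (x∈B ∷ z∈B ∷ y∈B ∷ []) =
      knuth₁ (f-mono-≤ x∈B y∈B x≤y) (f-mono y∈B z∈B y<z)
    ∼-map (knuth₂ x<y y≤z) (y∈B ∷ z∈B ∷ x∈B ∷ []) =
      knuth₂ (f-mono x∈B y∈B x<y) (f-mono-≤ y∈B z∈B y≤z)

  module _ {I : Pred A a} (I? : Decidable I) (I-interval : IsInterval I) where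

    private
      filter-swap : ∀ {s t} w w′ →
                    (I s → I t → filter I? (w ++ s ∷ t ∷ w′) ∼ filter I? (w ++ t ∷ s ∷ w′)) →
                    filter I? (w ++ s ∷ t ∷ w′) ∼ filter I? (w ++ t ∷ s ∷ w′)
      filter-swap {s} {t} w w′ both-kept with I? s | I? t
      ... | yes Is | yes It = both-kept Is It
      ... | no ¬Is | _      = ≡⇒∼ (filter-swap-dropped I? ¬Is w w′)
      ... | _      | no ¬It = ≡⇒∼ (sym (filter-swap-dropped I? ¬It w w′))

      filter-kept : All I u → All I v → u ∼ v → filter I? u ∼ filter I? v
      filter-kept Iu Iv u∼v =
        ∼-trans (≡⇒∼ (filter-all I? Iu)) (∼-trans u∼v (≡⇒∼ (sym (filter-all I? Iv))))

      between : I x → I z → x ≤ y → y ≤ z → I y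
      between Ix Iz (inj₂ refl) _           = Ix
      between Ix Iz _           (inj₂ refl) = Iz
      between Ix Iz (inj₁ x<y)  (inj₁ y<z)  = I-interval Ix Iz x<y y<z

    ∼-filter : u ∼ v → filter I? u ∼ filter I? v
    ∼-filter ∼-refl = ∼-refl
    ∼-filter (∼-sym v∼u) = ∼-sym (∼-filter v∼u)
    ∼-filter (∼-trans u∼w w∼v) = ∼-trans (∼-filter u∼w) (∼-filter w∼v)
    ∼-filter (∼-cong {u} {u′} {v} {v′} u∼u′ v∼v′) =
      ∼-trans (≡⇒∼ (filter-++ I? u v))
        (∼-trans (∼-cong (∼-filter u∼u′) (∼-filter v∼v′)) (≡⇒∼ (sym (filter-++ I? u′ v′))))
    ∼-filter (knuth₁ x≤y y<z) = filter-swap [] [ _ ] λ Ix Iz →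
      let Iy = between Ix Iz x≤y (inj₁ y<z)
      in filter-kept (Ix ∷ Iz ∷ Iy ∷ []) (Iz ∷ Ix ∷ Iy ∷ []) (knuth₁ x≤y y<z)
    ∼-filter (knuth₂ x<y y≤z) = filter-swap [ _ ] [] λ Iz Ix →
      let Iy = between Ix Iz (inj₁ x<y) y≤z
      in filter-kept (Iy ∷ Iz ∷ Ix ∷ []) (Iy ∷ Ix ∷ Iz ∷ []) (knuth₂ x<y y≤z)

module PlacticCommutation {a r} {A : Set a} {_<_ : Rel A r} (sto : IsStrictTotalOrder _≡_ _<_) where
  open Alph sto
  open Alphabet sto
  open IsStrictTotalOrder sto using (_<?_) renaming (trans to <-trans)
  open SetoidPermutation (Monoid.setoid PlacMonoid) using () renaming (_↭_ to _↭ₚ_)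

  module ProductTerms {q} {Q : Rel A q} (Q? : Decidable₂ Q) (pw : A × A → Word)
                      (pw-injective : ∀ {p p′} → pw p ≡ pw p′ → p ≡ p′) where

    Pairs : List A → List (A × A)
    Pairs B = filter (λ p → Q? (proj₁ p) (proj₂ p)) (cartesianProduct B B)

    F : List A → List Word
    F B = map pw (Pairs B)

    data LeftTerm (B : List A) : Word → Set (a ⊔ q) where
      term : ∀ {x u v} → x ∈ B → u ∈ B → v ∈ B → Q u v → LeftTerm B (x ∷ pw (u , v))

    data RightTerm (B : List A) : Word → Set (a ⊔ q) where
      term : ∀ {x u v} → x ∈ B → u ∈ B → v ∈ B → Q u v → RightTerm B (pw (u , v) ++ [ x ])

    private
      leftTerms rightTerms : List A → List Word
      leftTerms  B = map (λ xp → proj₁ xp ∷ pw (proj₂ xp)) (cartesianProduct B (Pairs B))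
      rightTerms B = map (λ px → pw (proj₁ px) ++ [ proj₂ px ]) (cartesianProduct (Pairs B) B)

      S1·F≡leftTerms : ∀ B → mult (S1 B) (F B) ≡ leftTerms B
      S1·F≡leftTerms B = cartesianProductWith-map _++_ _,_ (λ _ _ → refl) B (Pairs B)

      F·S1≡rightTerms : ∀ B → mult (F B) (S1 B) ≡ rightTerms B
      F·S1≡rightTerms B = cartesianProductWith-map _++_ _,_ (λ _ _ → refl) (Pairs B) B

      ∈-Pairs⁻ : ∀ {B u v} → (u , v) ∈ Pairs B → u ∈ B × v ∈ B × Q u v
      ∈-Pairs⁻ {B} uv∈ with uv∈B² , Quv ← ∈-filter⁻ _ uv∈
                       with u∈B , v∈B ← ∈-cartesianProduct⁻ B B uv∈B² = u∈B , v∈B , Quv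

      ∈-Pairs⁺ : ∀ {B u v} → u ∈ B → v ∈ B → Q u v → (u , v) ∈ Pairs B
      ∈-Pairs⁺ u∈B v∈B Quv = ∈-filter⁺ _ (∈-cartesianProduct⁺ u∈B v∈B) Quv

      ∈-leftTerms⁻ : ∀ {B z} → z ∈ leftTerms B → LeftTerm B z
      ∈-leftTerms⁻ {B} z∈ with (x , (u , v)) , xp∈ , refl ← ∈-map⁻ _ z∈
                             with x∈B , p∈ ← ∈-cartesianProduct⁻ B (Pairs B) xp∈
                             with u∈B , v∈B , Quv ← ∈-Pairs⁻ p∈ = term x∈B u∈B v∈B Quv

      ∈-leftTerms⁺ : ∀ {B z} → LeftTerm B z → z ∈ leftTerms B
      ∈-leftTerms⁺ (term x∈B u∈B v∈B Quv) =
        ∈-map⁺ _ (∈-cartesianProduct⁺ x∈B (∈-Pairs⁺ u∈B v∈B Quv))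

      ∈-rightTerms⁻ : ∀ {B z} → z ∈ rightTerms B → RightTerm B z
      ∈-rightTerms⁻ {B} z∈ with ((u , v) , x) , px∈ , refl ← ∈-map⁻ _ z∈
                              with p∈ , x∈B ← ∈-cartesianProduct⁻ (Pairs B) B px∈
                              with u∈B , v∈B , Quv ← ∈-Pairs⁻ p∈ = term x∈B u∈B v∈B Quv

      ∈-rightTerms⁺ : ∀ {B z} → RightTerm B z → z ∈ rightTerms B
      ∈-rightTerms⁺ (term x∈B u∈B v∈B Quv) =
        ∈-map⁺ _ (∈-cartesianProduct⁺ (∈-Pairs⁺ u∈B v∈B Quv) x∈B)

      Pairs-unique : ∀ {B} → Unique B → Unique (Pairs B)
      Pairs-unique B! = Unique.filter⁺ _ (Unique.cartesianProduct⁺ B! B!)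

      leftTerms-unique : ∀ {B} → Unique B → Unique (leftTerms B)
      leftTerms-unique B! = Unique.map⁺ injective (Unique.cartesianProduct⁺ B! (Pairs-unique B!))
        where
        injective : ∀ {xp xp′} → proj₁ xp ∷ pw (proj₂ xp) ≡ proj₁ xp′ ∷ pw (proj₂ xp′) → xp ≡ xp′
        injective {_ , _} {_ , _} eq with refl , pw≡ ← ∷-injective eq
                                     with refl ← pw-injective pw≡ = refl

      rightTerms-unique : ∀ {B} → Unique B → Unique (rightTerms B)
      rightTerms-unique B! = Unique.map⁺ injective (Unique.cartesianProduct⁺ (Pairs-unique B!) B!)
        where
        injective : ∀ {px px′} → pw (proj₁ px) ++ [ proj₂ px ] ≡ pw (proj₁ px′) ++ [ proj₂ px′ ] →
                    px ≡ px′
        injective {p , _} {p′ , _} eq with pw≡ , refl ← ∷ʳ-injective (pw p) (pw p′) eq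
                                      with refl ← pw-injective pw≡ = refl

    S1·F↭F·S1 : (g g⁻¹ : Word → Word) →
      (∀ {B z} → LeftTerm B z → RightTerm B (g z)) →
      (∀ {B z} → RightTerm B z → LeftTerm B (g⁻¹ z)) →
      (∀ {B z} → LeftTerm B z → g⁻¹ (g z) ≡ z) → (∀ {B z} → RightTerm B z → g (g⁻¹ z) ≡ z) →
      (∀ {B z} → LeftTerm B z → z ∼ g z) →
      ∀ {B} → Unique B → mult (S1 B) (F B) ↭ₚ mult (F B) (S1 B)
    S1·F↭F·S1 g g⁻¹ g-term g⁻¹-term g⁻¹∘g g∘g⁻¹ g-∼ {B} B! =
      subst₂ _↭ₚ_ (sym (S1·F≡leftTerms B)) (sym (F·S1≡rightTerms B))
        (↭-of-bijection (Monoid.setoid PlacMonoid) g g⁻¹ (leftTerms-unique B!) (rightTerms-unique B!)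
          (∈-rightTerms⁺ ∘ g-term ∘ ∈-leftTerms⁻ {B})
          (∈-leftTerms⁺ ∘ g⁻¹-term ∘ ∈-rightTerms⁻ {B})
          (g⁻¹∘g ∘ ∈-leftTerms⁻ {B}) (g∘g⁻¹ ∘ ∈-rightTerms⁻ {B}) (g-∼ ∘ ∈-leftTerms⁻ {B}))

  column : A × A → Word
  column (u , v) = v ∷ u ∷ []

  column-injective : ∀ {p p′} → column p ≡ column p′ → p ≡ p′
  column-injective {_ , _} {_ , _} refl = refl

  module Column = ProductTerms _<?_ column column-injective

  private variable
    x u v : A

  column-shift column-unshift : Word → Word
  column-shift (x ∷ v ∷ u ∷ []) =
    if does (u <? x)
    then (if does (v <? x) then x ∷ v ∷ u ∷ [] else x ∷ u ∷ v ∷ [])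
    else v ∷ x ∷ u ∷ []
  column-shift w = w
  column-unshift (v ∷ u ∷ x ∷ []) =
    if does (x <? u) then v ∷ u ∷ x ∷ []
    else if does (x <? v) then u ∷ v ∷ x ∷ []
    else v ∷ x ∷ u ∷ []
  column-unshift w = w

  -- Proofs about the shifts split on placement views and use these equations: a `with` on the
  -- decisions themselves would not reach the occurrences that only appear after unfolding.
  column-shift-below : x ≤ u → column-shift (x ∷ v ∷ u ∷ []) ≡ v ∷ x ∷ u ∷ []
  column-shift-below {x} {u} x≤u rewrite dec-false (u <? x) (≤⇒≯ x≤u) = refl

  column-shift-between : u < x → x ≤ v → column-shift (x ∷ v ∷ u ∷ []) ≡ x ∷ u ∷ v ∷ []
  column-shift-between {u} {x} {v} u<x x≤v rewrite dec-true (u <? x) u<x | dec-false (v <? x) (≤⇒≯ x≤v) = refl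

  column-shift-above : u < x → v < x → column-shift (x ∷ v ∷ u ∷ []) ≡ x ∷ v ∷ u ∷ []
  column-shift-above {u} {x} {v} u<x v<x rewrite dec-true (u <? x) u<x | dec-true (v <? x) v<x = refl

  column-unshift-below : x < u → column-unshift (v ∷ u ∷ x ∷ []) ≡ v ∷ u ∷ x ∷ []
  column-unshift-below {x} {u} x<u rewrite dec-true (x <? u) x<u = refl

  column-unshift-between : u ≤ x → x < v → column-unshift (v ∷ u ∷ x ∷ []) ≡ u ∷ v ∷ x ∷ []
  column-unshift-between {u} {x} {v} u≤x x<v
    rewrite dec-false (x <? u) (≤⇒≯ u≤x) | dec-true (x <? v) x<v = refl

  column-unshift-above : u ≤ x → v ≤ x → column-unshift (v ∷ u ∷ x ∷ []) ≡ v ∷ x ∷ u ∷ []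
  column-unshift-above {u} {x} {v} u≤x v≤x
    rewrite dec-false (x <? u) (≤⇒≯ u≤x) | dec-false (x <? v) (≤⇒≯ v≤x) = refl

  column-shift-term : ∀ {B z} → Column.LeftTerm B z → Column.RightTerm B (column-shift z)
  column-shift-term (Column.term {x} {u} {v} x∈B u∈B v∈B u<v) with ≤-placement x u v
  ... | below x≤u       rewrite column-shift-below {v = v} x≤u = Column.term u∈B x∈B v∈B (≤-<-trans x≤u u<v)
  ... | between u<x x≤v rewrite column-shift-between u<x x≤v = Column.term v∈B u∈B x∈B u<x
  ... | above u<x v<x   rewrite column-shift-above u<x v<x = Column.term u∈B v∈B x∈B v<x

  column-unshift-term : ∀ {B z} → Column.RightTerm B z → Column.LeftTerm B (column-unshift z)
  column-unshift-term (Column.term {x} {u} {v} x∈B u∈B v∈B u<v) with <-placement x u v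
  ... | below x<u       rewrite column-unshift-below {v = v} x<u = Column.term v∈B x∈B u∈B x<u
  ... | between u≤x x<v rewrite column-unshift-between u≤x x<v = Column.term u∈B x∈B v∈B x<v
  ... | above u≤x v≤x   rewrite column-unshift-above u≤x v≤x = Column.term v∈B u∈B x∈B (<-≤-trans u<v v≤x)

  column-unshift∘shift : ∀ {B z} → Column.LeftTerm B z → column-unshift (column-shift z) ≡ z
  column-unshift∘shift (Column.term {x} {u} {v} _ _ _ u<v) with ≤-placement x u v
  ... | below x≤u       rewrite column-shift-below {v = v} x≤u = column-unshift-between x≤u u<v
  ... | between u<x x≤v rewrite column-shift-between u<x x≤v = column-unshift-above (inj₁ u<v) x≤v
  ... | above u<x v<x   rewrite column-shift-above u<x v<x = column-unshift-below u<v

  column-shift∘unshift : ∀ {B z} → Column.RightTerm B z → column-shift (column-unshift z) ≡ z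
  column-shift∘unshift (Column.term {x} {u} {v} _ _ _ u<v) with <-placement x u v
  ... | below x<u       rewrite column-unshift-below {v = v} x<u = column-shift-above (<-trans x<u u<v) u<v
  ... | between u≤x x<v rewrite column-unshift-between u≤x x<v = column-shift-below u≤x
  ... | above u≤x v≤x   rewrite column-unshift-above u≤x v≤x = column-shift-between u<v v≤x

  column-shift-∼ : ∀ {B z} → Column.LeftTerm B z → z ∼ column-shift z
  column-shift-∼ (Column.term {x} {u} {v} _ _ _ u<v) with ≤-placement x u v
  ... | below x≤u       rewrite column-shift-below {v = v} x≤u = knuth₁ x≤u u<v
  ... | between u<x x≤v rewrite column-shift-between u<x x≤v = knuth₂ u<x x≤v
  ... | above u<x v<x   rewrite column-shift-above u<x v<x = ∼-refl

  S1·S11↭S11·S1 : ∀ {B} → Unique B → mult (S1 B) (S11 B) ↭ₚ mult (S11 B) (S1 B)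
  S1·S11↭S11·S1 = Column.S1·F↭F·S1 column-shift column-unshift column-shift-term column-unshift-term
                    column-unshift∘shift column-shift∘unshift column-shift-∼

  row : A × A → Word
  row (u , v) = u ∷ v ∷ []

  row-injective : ∀ {p p′} → row p ≡ row p′ → p ≡ p′
  row-injective {_ , _} {_ , _} refl = refl

  module Row = ProductTerms _≤?_ row row-injective

  row-shift row-unshift : Word → Word
  row-shift (x ∷ u ∷ v ∷ []) =
    if does (u <? x)
    then (if does (v <? x) then u ∷ x ∷ v ∷ [] else x ∷ v ∷ u ∷ [])
    else x ∷ u ∷ v ∷ []
  row-shift w = w
  row-unshift (u ∷ v ∷ x ∷ []) =
    if does (x <? u) then u ∷ x ∷ v ∷ []
    else if does (x <? v) then v ∷ u ∷ x ∷ []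
    else u ∷ v ∷ x ∷ []
  row-unshift w = w

  row-shift-below : x ≤ u → row-shift (x ∷ u ∷ v ∷ []) ≡ x ∷ u ∷ v ∷ []
  row-shift-below {x} {u} x≤u rewrite dec-false (u <? x) (≤⇒≯ x≤u) = refl

  row-shift-between : u < x → x ≤ v → row-shift (x ∷ u ∷ v ∷ []) ≡ x ∷ v ∷ u ∷ []
  row-shift-between {u} {x} {v} u<x x≤v rewrite dec-true (u <? x) u<x | dec-false (v <? x) (≤⇒≯ x≤v) = refl

  row-shift-above : u < x → v < x → row-shift (x ∷ u ∷ v ∷ []) ≡ u ∷ x ∷ v ∷ []
  row-shift-above {u} {x} {v} u<x v<x rewrite dec-true (u <? x) u<x | dec-true (v <? x) v<x = refl

  row-unshift-below : x < u → row-unshift (u ∷ v ∷ x ∷ []) ≡ u ∷ x ∷ v ∷ []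
  row-unshift-below {x} {u} x<u rewrite dec-true (x <? u) x<u = refl

  row-unshift-between : u ≤ x → x < v → row-unshift (u ∷ v ∷ x ∷ []) ≡ v ∷ u ∷ x ∷ []
  row-unshift-between {u} {x} {v} u≤x x<v rewrite dec-false (x <? u) (≤⇒≯ u≤x) | dec-true (x <? v) x<v = refl

  row-unshift-above : u ≤ x → v ≤ x → row-unshift (u ∷ v ∷ x ∷ []) ≡ u ∷ v ∷ x ∷ []
  row-unshift-above {u} {x} {v} u≤x v≤x
    rewrite dec-false (x <? u) (≤⇒≯ u≤x) | dec-false (x <? v) (≤⇒≯ v≤x) = refl

  row-shift-term : ∀ {B z} → Row.LeftTerm B z → Row.RightTerm B (row-shift z)
  row-shift-term (Row.term {x} {u} {v} x∈B u∈B v∈B u≤v) with ≤-placement x u v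
  ... | below x≤u       rewrite row-shift-below {v = v} x≤u = Row.term v∈B x∈B u∈B x≤u
  ... | between u<x x≤v rewrite row-shift-between u<x x≤v = Row.term u∈B x∈B v∈B x≤v
  ... | above u<x v<x   rewrite row-shift-above u<x v<x = Row.term v∈B u∈B x∈B (inj₁ u<x)

  row-unshift-term : ∀ {B z} → Row.RightTerm B z → Row.LeftTerm B (row-unshift z)
  row-unshift-term (Row.term {x} {u} {v} x∈B u∈B v∈B u≤v) with <-placement x u v
  ... | below x<u       rewrite row-unshift-below {v = v} x<u = Row.term u∈B x∈B v∈B (inj₁ (<-≤-trans x<u u≤v))
  ... | between u≤x x<v rewrite row-unshift-between u≤x x<v = Row.term v∈B u∈B x∈B u≤x
  ... | above u≤x v≤x   rewrite row-unshift-above u≤x v≤x = Row.term u∈B v∈B x∈B v≤x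

  row-unshift∘shift : ∀ {B z} → Row.LeftTerm B z → row-unshift (row-shift z) ≡ z
  row-unshift∘shift (Row.term {x} {u} {v} _ _ _ u≤v) with ≤-placement x u v
  ... | below x≤u       rewrite row-shift-below {v = v} x≤u = row-unshift-above (≤-trans x≤u u≤v) u≤v
  ... | between u<x x≤v rewrite row-shift-between u<x x≤v = row-unshift-below u<x
  ... | above u<x v<x   rewrite row-shift-above u<x v<x = row-unshift-between u≤v v<x

  row-shift∘unshift : ∀ {B z} → Row.RightTerm B z → row-shift (row-unshift z) ≡ z
  row-shift∘unshift (Row.term {x} {u} {v} _ _ _ u≤v) with <-placement x u v
  ... | below x<u       rewrite row-unshift-below {v = v} x<u = row-shift-between x<u u≤v
  ... | between u≤x x<v rewrite row-unshift-between u≤x x<v = row-shift-above (≤-<-trans u≤x x<v) x<v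
  ... | above u≤x v≤x   rewrite row-unshift-above u≤x v≤x = row-shift-below u≤v

  row-shift-∼ : ∀ {B z} → Row.LeftTerm B z → z ∼ row-shift z
  row-shift-∼ (Row.term {x} {u} {v} _ _ _ u≤v) with ≤-placement x u v
  ... | below x≤u       rewrite row-shift-below {v = v} x≤u = ∼-refl
  ... | between u<x x≤v rewrite row-shift-between u<x x≤v = ∼-sym (knuth₂ u<x x≤v)
  ... | above u<x v<x   rewrite row-shift-above u<x v<x = ∼-sym (knuth₁ u≤v v<x)

  S1·S2↭S2·S1 : ∀ {B} → Unique B → mult (S1 B) (S2 B) ↭ₚ mult (S2 B) (S1 B)
  S1·S2↭S2·S1 = Row.S1·F↭F·S1 row-shift row-unshift row-shift-term row-unshift-term
                  row-unshift∘shift row-shift∘unshift row-shift-∼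

module OrderEmbedding {a r a′ r′} {A : Set a} {_<_ : Rel A r} {A′ : Set a′} {_<′_ : Rel A′ r′}
                      (sto : IsStrictTotalOrder _≡_ _<_) (sto′ : IsStrictTotalOrder _≡_ _<′_)
                      (f : A′ → A) (f-mono : ∀ {x y} → x <′ y → f x < f y) where
  open Alph sto
  open Alphabet sto using (<⇒≢; Between; Between?)
  open IsStrictTotalOrder sto using (_<?_; _≟_; asym)
  open IsStrictTotalOrder sto′ using (compare) renaming (_<?_ to _<?′_; _≟_ to _≟′_)
  module A′ = Alph sto′
  module Alphabet′ = Alphabet sto′

  private variable
    x y : A′

  f-reflects-< : f x < f y ⇔ x <′ y
  f-reflects-< {x} {y} = mk⇔ reflect f-mono
    where
    reflect : f x < f y → x <′ y
    reflect fx<fy with compare x y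
    ... | tri< x<y _ _ = x<y
    ... | tri≈ _ refl _ = contradiction refl (<⇒≢ fx<fy)
    ... | tri> _ _ y<x = contradiction fx<fy (asym (f-mono y<x))

  f-reflects-≡ : f x ≡ f y ⇔ x ≡ y
  f-reflects-≡ {x} {y} = mk⇔ injective (cong f)
    where
    injective : f x ≡ f y → x ≡ y
    injective fx≡fy with compare x y
    ... | tri< x<y _ _ = contradiction fx≡fy (<⇒≢ (f-mono x<y))
    ... | tri≈ _ x≡y _ = x≡y
    ... | tri> _ _ y<x = contradiction (sym fx≡fy) (<⇒≢ (f-mono y<x))

  f-reflects-≤ : f x ≤ f y ⇔ x A′.≤ y
  f-reflects-≤ = mk⇔ (Sum.map (Equivalence.to f-reflects-<) (Equivalence.to f-reflects-≡))
                     (Sum.map (Equivalence.from f-reflects-<) (Equivalence.from f-reflects-≡))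

  S1-map : ∀ B → S1 (map f B) ≡ map (map f) (A′.S1 B)
  S1-map B = trans (sym (map-∘ B)) (map-∘ B)

  private
    pairs-map : ∀ {p p′} {P : Pred (A × A) p} {P′ : Pred (A′ × A′) p′} (P? : Decidable P) (P′? : Decidable P′)
                (pw : A × A → Word) (pw′ : A′ × A′ → A′.Word) →
                (∀ q → does (P? (Product.map f f q)) ≡ does (P′? q)) →
                (∀ q → pw (Product.map f f q) ≡ map f (pw′ q)) → ∀ B →
                map pw (filter P? (cartesianProduct (map f B) (map f B))) ≡
                map (map f) (map pw′ (filter P′? (cartesianProduct B B)))
    pairs-map P? P′? pw pw′ agree natural B = begin
      map pw (filter P? (cartesianProduct (map f B) (map f B)))
        ≡⟨ cong (map pw ∘ filter P?) (cartesianProductWith-map _,_ _,_ (λ _ _ → refl) B B) ⟩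
      map pw (filter P? (map (Product.map f f) B²))
        ≡⟨ cong (map pw) (filter-map P? P′? agree B²) ⟩
      map pw (map (Product.map f f) (filter P′? B²))
        ≡⟨ map-∘ (filter P′? B²) ⟨
      map (pw ∘ Product.map f f) (filter P′? B²)
        ≡⟨ map-cong natural (filter P′? B²) ⟩
      map (map f ∘ pw′) (filter P′? B²)
        ≡⟨ map-∘ (filter P′? B²) ⟩
      map (map f) (map pw′ (filter P′? B²)) ∎
      where
      open ≡-Reasoning
      B² = cartesianProduct B B

  S11-map : ∀ B → S11 (map f B) ≡ map (map f) (A′.S11 B)
  S11-map = pairs-map _ _ _ _ (λ (x , y) → does-⇔ f-reflects-< (f x <? f y) (x <?′ y)) (λ _ → refl)

  S2-map : ∀ B → S2 (map f B) ≡ map (map f) (A′.S2 B)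
  S2-map = pairs-map _ _ _ _ (λ (x , y) → does-⇔ f-reflects-≤ (f x ≤? f y) (x A′.≤? y)) (λ _ → refl)

  mult-map : ∀ us vs → mult (map (map f) us) (map (map f) vs) ≡ map (map f) (A′.mult us vs)
  mult-map = cartesianProductWith-map _++_ _++_ (λ u v → sym (map-++ f u v))

  count-map : ∀ k ws → length (filter (f k ≟_) (map f ws)) ≡ length (filter (k ≟′_) ws)
  count-map k ws =
    trans (cong length (filter-map (f k ≟_) (k ≟′_) (λ i → does-⇔ f-reflects-≡ (f k ≟ f i) (k ≟′ i)) ws))
          (length-map f (filter (k ≟′_) ws))

  Between-map : ∀ i j ws → filter (Between? (f i) (f j)) (map f ws) ≡ map f (filter (Alphabet′.Between? i j) ws)
  Between-map i j = filter-map (Between? (f i) (f j)) (Alphabet′.Between? i j) λ k →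
    cong₂ _∧_ (isYes-≤ i k) (isYes-≤ k j)
    where
    isYes-≤ : ∀ x y → isYes (f x ≤? f y) ≡ isYes (x A′.≤? y)
    isYes-≤ x y = trans (isYes≗does (f x ≤? f y))
                    (trans (does-⇔ f-reflects-≤ (f x ≤? f y) (x A′.≤? y)) (sym (isYes≗does (x A′.≤? y))))

module Presentations {a r} {A : Set a} {_<_ : Rel A r} (sto : IsStrictTotalOrder _≡_ _<_)
                     {c ℓ} (X : Alph.Presentation sto c ℓ) where
  open Alph sto
  open Presentation X renaming (refl to ≈-refl; sym to ≈-sym; trans to ≈-trans)

  private variable
    u u′ v v′ : Word

  φ-++-cong : φ u ≈ φ u′ → φ v ≈ φ v′ → φ (u ++ v) ≈ φ (u′ ++ v′)
  φ-++-cong {u} {u′} {v} {v′} φu≈φu′ φv≈φv′ =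
    ≈-trans (φ-∙ u v) (≈-trans (∙-cong φu≈φu′ φv≈φv′) (≈-sym (φ-∙ u′ v′)))

  φ-↭ : (∀ s t → φ (s ∷ t ∷ []) ≈ φ (t ∷ s ∷ [])) → u ↭ v → φ u ≈ φ v
  φ-↭ comm ↭.refl         = ≈-refl
  φ-↭ comm (prep x u↭v)   = φ-++-cong {[ x ]} ≈-refl (φ-↭ comm u↭v)
  φ-↭ comm (swap x y u↭v) = φ-++-cong {x ∷ y ∷ []} (comm x y) (φ-↭ comm u↭v)
  φ-↭ comm (↭.trans u↭w w↭v) = ≈-trans (φ-↭ comm u↭w) (φ-↭ comm w↭v)

  φ-∼ : (∀ {x y z} → x ≤ y → y < z → φ (x ∷ z ∷ y ∷ []) ≈ φ (z ∷ x ∷ y ∷ [])) →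
        (∀ {x y z} → x < y → y ≤ z → φ (y ∷ z ∷ x ∷ []) ≈ φ (y ∷ x ∷ z ∷ [])) →
        u ∼ v → φ u ≈ φ v
  φ-∼ k₁ k₂ ∼-refl              = ≈-refl
  φ-∼ k₁ k₂ (∼-sym v∼u)         = ≈-sym (φ-∼ k₁ k₂ v∼u)
  φ-∼ k₁ k₂ (∼-trans u∼w w∼v)   = ≈-trans (φ-∼ k₁ k₂ u∼w) (φ-∼ k₁ k₂ w∼v)
  φ-∼ k₁ k₂ (∼-cong u∼u′ v∼v′)  = φ-++-cong (φ-∼ k₁ k₂ u∼u′) (φ-∼ k₁ k₂ v∼v′)
  φ-∼ k₁ k₂ (knuth₁ x≤y y<z)    = k₁ x≤y y<z
  φ-∼ k₁ k₂ (knuth₂ x<y y≤z)    = k₂ x<y y≤z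

module KnuthRelations {a r} {A : Set a} {_<_ : Rel A r} (sto : IsStrictTotalOrder _≡_ _<_)
                      {c ℓ} (X : Alph.Presentation sto c ℓ) (c1 : Alph.Cond1 sto X)
                      (c3 : Alph.Cond3 sto X) (c4 : Alph.Cond4 sto X) where
  open Alph sto
  open Alphabet sto using (<⇒≢; Between; Between?; Between-isInterval)
  open IsStrictTotalOrder sto using (compare; _<?_; _≟_; asym) renaming (trans to <-trans; irrefl to <-irrefl)
  open Presentation X renaming (refl to ≈-refl; sym to ≈-sym; trans to ≈-trans)
  open Presentations sto X
  open SetoidPermutation setoid using () renaming (↭-sym to ≈ℤ-sym)

  infix 4 _≈ℤ_
  _≈ℤ_ : List Word → List Word → Set (c ⊔ ℓ)
  _≈ℤ_ = _≈ℤM_ X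

  private variable
    s t x y : A
    u v : Word

  ≈⇒↭ : φ u ≈ φ v → u ↭ v
  ≈⇒↭ {u} {v} φu≈φv = ↭-trans (↭-sym (c1 u)) (↭-trans (ψ-cong φu≈φv) (c1 v))

  swap-transport : x < y → φ (x ∷ y ∷ []) ≈ φ (y ∷ x ∷ []) → s < t → φ (s ∷ t ∷ []) ≈ φ (t ∷ s ∷ [])
  swap-transport {x} {y} {s} {t} x<y comm s<t =
    ≡.subst₂ (λ s′ t′ → φ (s′ ∷ t′ ∷ []) ≈ φ (t′ ∷ s′ ∷ [])) fx≡s fy≡t
      (c3 (x ∷ y ∷ []) (s ∷ t ∷ []) x≢y s≢t f f-into f-mono (x ∷ y ∷ []) (y ∷ x ∷ [])
          (here refl ∷ there (here refl) ∷ []) (there (here refl) ∷ here refl ∷ []) comm)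
    where
    f : A → A
    f w = if does (w <? y) then s else t
    fx≡s : f x ≡ s
    fx≡s = cong (if_then s else t) (dec-true (x <? y) x<y)
    fy≡t : f y ≡ t
    fy≡t = cong (if_then s else t) (dec-false (y <? y) (<-irrefl refl))
    x≢y : Unique (x ∷ y ∷ [])
    x≢y = (<⇒≢ x<y ∷ []) ∷ [] ∷ []
    s≢t : Unique (s ∷ t ∷ [])
    s≢t = (<⇒≢ s<t ∷ []) ∷ [] ∷ []
    f-into : ∀ {w} → w ∈ x ∷ y ∷ [] → f w ∈ s ∷ t ∷ []
    f-into (here refl)         = here fx≡s
    f-into (there (here refl)) = there (here fy≡t)
    f-mono : ∀ {w w′} → w ∈ x ∷ y ∷ [] → w′ ∈ x ∷ y ∷ [] → w < w′ → f w < f w′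
    f-mono (here refl)         (there (here refl)) _   = ≡.subst₂ _<_ (≡.sym fx≡s) (≡.sym fy≡t) s<t
    f-mono (here refl)         (here refl)         w<w = contradiction w<w (<-irrefl refl)
    f-mono (there (here refl)) (there (here refl)) w<w = contradiction w<w (<-irrefl refl)
    f-mono (there (here refl)) (here refl)         y<x = contradiction y<x (asym x<y)

  commuting-pair : x < y → φ (x ∷ y ∷ []) ≈ φ (y ∷ x ∷ []) → u ↭ v → φ u ≈ φ v
  commuting-pair x<y comm = φ-↭ λ s t → case s t
    where
    case : ∀ s t → φ (s ∷ t ∷ []) ≈ φ (t ∷ s ∷ [])
    case s t with compare s t
    ... | tri< s<t _ _ = swap-transport x<y comm s<t
    ... | tri≈ _ refl _ = ≈-refl
    ... | tri> _ _ t<s = ≈-sym (swap-transport x<y comm t<s)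

  -- Coding letters by Fin n makes S₁, S₁₁, S₂, contents and interval restrictions compute on
  -- coded words, so that partner lists the candidates for a closed word explicitly.
  module Letters {n} (letter : Fin n → A) (letter-mono : ∀ {i j} → i Fin.< j → letter i < letter j) where
    private
      module E = OrderEmbedding sto Fin.<-isStrictTotalOrder letter letter-mono
      module Codes = Alph (Fin.<-isStrictTotalOrder {n})
      open IsStrictTotalOrder (Fin.<-isStrictTotalOrder {n}) using () renaming (_≟_ to _≟ᶜ_)
      open DecMembership (≡-dec _≟ᶜ_) using (_∈?_)

      codes : List (Fin n)
      codes = allFin n

    decode : List (Fin n) → Word
    decode = map letter

    private
      letters-unique : Unique (decode codes)
      letters-unique = Unique.map⁺ (Equivalence.to E.f-reflects-≡) (Unique.allFin⁺ n)

      mult-decode : ∀ (F G : List A → List Word) (F′ G′ : List (Fin n) → List Codes.Word) →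
                    (∀ B → F (decode B) ≡ map decode (F′ B)) → (∀ B → G (decode B) ≡ map decode (G′ B)) →
                    mult (F (decode codes)) (G (decode codes)) ≡ map decode (Codes.mult (F′ codes) (G′ codes))
      mult-decode F G F′ G′ F-map G-map =
        ≡.trans (cong₂ mult (F-map codes) (G-map codes)) (E.mult-map (F′ codes) (G′ codes))

    S1·S11-decoded : Cond2 X → map decode (Codes.mult (Codes.S1 codes) (Codes.S11 codes)) ≈ℤ
                               map decode (Codes.mult (Codes.S11 codes) (Codes.S1 codes))
    S1·S11-decoded c2 =
      subst₂ _≈ℤ_ (mult-decode S1 S11 Codes.S1 Codes.S11 E.S1-map E.S11-map)
                  (mult-decode S11 S1 Codes.S11 Codes.S1 E.S11-map E.S1-map)
                  (c2 (decode codes) letters-unique)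

    S1·S2-decoded : Cond2' X → map decode (Codes.mult (Codes.S1 codes) (Codes.S2 codes)) ≈ℤ
                               map decode (Codes.mult (Codes.S2 codes) (Codes.S1 codes))
    S1·S2-decoded c2′ =
      subst₂ _≈ℤ_ (mult-decode S1 S2 Codes.S1 Codes.S2 E.S1-map E.S2-map)
                  (mult-decode S2 S1 Codes.S2 Codes.S1 E.S2-map E.S1-map)
                  (c2′ (decode codes) letters-unique)

    count : Fin n → List (Fin n) → ℕ.ℕ
    count k = length ∘ filter (k ≟ᶜ_)

    SameContent : List (Fin n) → List (Fin n) → Set
    SameContent is js = All (λ k → count k is ≡ count k js) codes

    sameContent? : Decidable₂ SameContent
    sameContent? is js = all? (λ k → count k is ℕ.≟ count k js) codes

    ≈⇒SameContent : ∀ {is js} → φ (decode is) ≈ φ (decode js) → SameContent is js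
    ≈⇒SameContent {is} {js} φis≈φjs = All.tabulate λ {k} _ → begin
      count k is                                ≡⟨ E.count-map k is ⟨
      length (filter (letter k ≟_) (decode is)) ≡⟨ ↭-length (filter-↭ (letter k ≟_) (≈⇒↭ φis≈φjs)) ⟩
      length (filter (letter k ≟_) (decode js)) ≡⟨ E.count-map k js ⟩
      count k js                                ∎
      where open ≡-Reasoning

    private
      partner-unfiltered : ∀ {Ls Rs} → map decode Ls ≈ℤ map decode Rs → ∀ {is} → is ∈ Ls →
                           Any (λ js → φ (decode is) ≈ φ (decode js)) Rs
      partner-unfiltered Ls≈Rs is∈Ls = Any.map⁻ (Any.map⁻ (SetoidPermutationProperties.∈-resp-↭ setoid Ls≈Rs
        (Any.map⁺ (Any.map⁺ (Any.map (λ { refl → ≈-refl }) is∈Ls)))))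

    partner : ∀ {Ls Rs} → map decode Ls ≈ℤ map decode Rs → ∀ is → {True (is ∈? Ls)} →
              Any (λ js → φ (decode is) ≈ φ (decode js)) (filter (sameContent? is) Rs)
    partner Ls≈Rs is {is∈Ls} with found ← partner-unfiltered Ls≈Rs (toWitness is∈Ls)
                             with Any.filter⁺ (sameContent? is) found
    ... | inj₁ kept    = kept
    ... | inj₂ dropped = contradiction (≈⇒SameContent (Any.lookup-result found)) dropped

    restrict : ∀ i j {is js} → φ (decode is) ≈ φ (decode js) →
               φ (decode (filter (E.Alphabet′.Between? i j) is)) ≈
               φ (decode (filter (E.Alphabet′.Between? i j) js))
    restrict i j {is} {js} φis≈φjs =
      subst₂ (λ w w′ → φ w ≈ φ w′) (E.Between-map i j is) (E.Between-map i j js)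
        (c4 _ (Between? (letter i) (letter j)) Between-isInterval (decode is) (decode js) φis≈φjs)

  module ThreeLetters {a b c : A} (a<b : a < b) (b<c : b < c) where
    private
      letter : Fin 3 → A
      letter 0F = a
      letter 1F = b
      letter 2F = c

      letter-mono : ∀ {i j} → i Fin.< j → letter i < letter j
      letter-mono {0F} {1F} _ = a<b
      letter-mono {0F} {2F} _ = <-trans a<b b<c
      letter-mono {1F} {2F} _ = b<c
      letter-mono {0F} {0F} ()
      letter-mono {1F} {0F} ()
      letter-mono {1F} {1F} (ℕ.s≤s ())
      letter-mono {2F} {0F} ()
      letter-mono {2F} {1F} (ℕ.s≤s ())
      letter-mono {2F} {2F} (ℕ.s≤s (ℕ.s≤s ()))

      acb↭cab : a ∷ c ∷ b ∷ [] ↭ c ∷ a ∷ b ∷ []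
      acb↭cab = swap a c ↭.refl

      bca↭bac : b ∷ c ∷ a ∷ [] ↭ b ∷ a ∷ c ∷ []
      bca↭bac = prep b (swap c a ↭.refl)

    open Letters letter letter-mono

    knuth₁-by-S11 : Cond2 X → φ (a ∷ c ∷ b ∷ []) ≈ φ (c ∷ a ∷ b ∷ [])
    knuth₁-by-S11 c2 with partner (S1·S11-decoded c2) (0F ∷ 2F ∷ 1F ∷ [])
    ... | here acb≈bac                = commuting-pair a<b (restrict 0F 1F acb≈bac) acb↭cab
    ... | there (here acb≈cab)        = acb≈cab
    ... | there (there (here acb≈cba)) = commuting-pair a<b (restrict 0F 1F acb≈cba) acb↭cab
    ... | there (there (there ()))

    knuth₂-by-S11 : Cond2 X → φ (b ∷ c ∷ a ∷ []) ≈ φ (b ∷ a ∷ c ∷ [])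
    knuth₂-by-S11 c2 with partner (S1·S11-decoded c2) (1F ∷ 2F ∷ 0F ∷ [])
    ... | here bca≈bac                = bca≈bac
    ... | there (here bca≈cab)        = commuting-pair a<b (≈-sym (restrict 0F 1F bca≈cab)) bca↭bac
    ... | there (there (here bca≈cba)) = commuting-pair b<c (restrict 1F 2F bca≈cba) bca↭bac
    ... | there (there (there ()))

    knuth₁-by-S2 : Cond2' X → φ (a ∷ c ∷ b ∷ []) ≈ φ (c ∷ a ∷ b ∷ [])
    knuth₁-by-S2 c2′ with partner (S1·S2-decoded c2′) (2F ∷ 0F ∷ 1F ∷ [])
    ... | here cab≈abc                = commuting-pair b<c (≈-sym (restrict 1F 2F cab≈abc)) acb↭cab
    ... | there (here cab≈acb)        = ≈-sym cab≈acb
    ... | there (there (here cab≈bca)) = commuting-pair a<b (restrict 0F 1F cab≈bca) acb↭cab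
    ... | there (there (there ()))

    knuth₂-by-S2 : Cond2' X → φ (b ∷ c ∷ a ∷ []) ≈ φ (b ∷ a ∷ c ∷ [])
    knuth₂-by-S2 c2′ with partner (S1·S2-decoded c2′) (1F ∷ 0F ∷ 2F ∷ [])
    ... | here bac≈abc                = commuting-pair a<b (≈-sym (restrict 0F 1F bac≈abc)) bca↭bac
    ... | there (here bac≈acb)        = commuting-pair a<b (≈-sym (restrict 0F 1F bac≈acb)) bca↭bac
    ... | there (there (here bac≈bca)) = ≈-sym bac≈bca
    ... | there (there (there ()))

  module TwoLetters {a b : A} (a<b : a < b) where
    private
      letter : Fin 2 → A
      letter 0F = a
      letter 1F = b

      letter-mono : ∀ {i j} → i Fin.< j → letter i < letter j
      letter-mono {0F} {1F} _ = a<b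
      letter-mono {0F} {0F} ()
      letter-mono {1F} {0F} ()
      letter-mono {1F} {1F} (ℕ.s≤s ())

    open Letters letter letter-mono

    knuth₁-by-S11 : Cond2 X → φ (a ∷ b ∷ a ∷ []) ≈ φ (b ∷ a ∷ a ∷ [])
    knuth₁-by-S11 c2 with partner (S1·S11-decoded c2) (0F ∷ 1F ∷ 0F ∷ [])
    ... | here aba≈baa = aba≈baa
    ... | there ()

    knuth₂-by-S11 : Cond2 X → φ (b ∷ b ∷ a ∷ []) ≈ φ (b ∷ a ∷ b ∷ [])
    knuth₂-by-S11 c2 with partner (S1·S11-decoded c2) (1F ∷ 1F ∷ 0F ∷ [])
    ... | here bba≈bab = bba≈bab
    ... | there ()

    -- If baa is matched with aab, the partner of aba, which is aab or baa, settles the relation.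
    knuth₁-by-S2 : Cond2' X → φ (a ∷ b ∷ a ∷ []) ≈ φ (b ∷ a ∷ a ∷ [])
    knuth₁-by-S2 c2′ with partner (S1·S2-decoded c2′) (1F ∷ 0F ∷ 0F ∷ [])
    ... | there (here baa≈aba) = ≈-sym baa≈aba
    ... | there (there ())
    ... | here baa≈aab with partner (≈ℤ-sym (S1·S2-decoded c2′)) (0F ∷ 1F ∷ 0F ∷ [])
    ...   | here aba≈aab        = ≈-trans aba≈aab (≈-sym baa≈aab)
    ...   | there (here aba≈baa) = aba≈baa
    ...   | there (there ())

    knuth₂-by-S2 : Cond2' X → φ (b ∷ b ∷ a ∷ []) ≈ φ (b ∷ a ∷ b ∷ [])
    knuth₂-by-S2 c2′ with partner (S1·S2-decoded c2′) (1F ∷ 0F ∷ 1F ∷ [])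
    ... | there (here bab≈bba) = ≈-sym bab≈bba
    ... | there (there ())
    ... | here bab≈abb with partner (≈ℤ-sym (S1·S2-decoded c2′)) (1F ∷ 1F ∷ 0F ∷ [])
    ...   | here bba≈abb        = ≈-trans bba≈abb (≈-sym bab≈abb)
    ...   | there (here bba≈bab) = bba≈bab
    ...   | there (there ())

  φ-∼-by-S11 : Cond2 X → u ∼ v → φ u ≈ φ v
  φ-∼-by-S11 c2 = φ-∼ k₁ k₂
    where
    k₁ : ∀ {x y z} → x ≤ y → y < z → φ (x ∷ z ∷ y ∷ []) ≈ φ (z ∷ x ∷ y ∷ [])
    k₁ (inj₁ x<y)  y<z = ThreeLetters.knuth₁-by-S11 x<y y<z c2
    k₁ (inj₂ refl) y<z = TwoLetters.knuth₁-by-S11 y<z c2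
    k₂ : ∀ {x y z} → x < y → y ≤ z → φ (y ∷ z ∷ x ∷ []) ≈ φ (y ∷ x ∷ z ∷ [])
    k₂ x<y (inj₁ y<z)  = ThreeLetters.knuth₂-by-S11 x<y y<z c2
    k₂ x<y (inj₂ refl) = TwoLetters.knuth₂-by-S11 x<y c2

  φ-∼-by-S2 : Cond2' X → u ∼ v → φ u ≈ φ v
  φ-∼-by-S2 c2′ = φ-∼ k₁ k₂
    where
    k₁ : ∀ {x y z} → x ≤ y → y < z → φ (x ∷ z ∷ y ∷ []) ≈ φ (z ∷ x ∷ y ∷ [])
    k₁ (inj₁ x<y)  y<z = ThreeLetters.knuth₁-by-S2 x<y y<z c2′
    k₁ (inj₂ refl) y<z = TwoLetters.knuth₁-by-S2 y<z c2′
    k₂ : ∀ {x y z} → x < y → y ≤ z → φ (y ∷ z ∷ x ∷ []) ≈ φ (y ∷ x ∷ z ∷ [])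
    k₂ x<y (inj₁ y<z)  = ThreeLetters.knuth₂-by-S2 x<y y<z c2′
    k₂ x<y (inj₂ refl) = TwoLetters.knuth₂-by-S2 x<y c2′

module Initiality {a r} {A : Set a} {_<_ : Rel A r} (sto : IsStrictTotalOrder _≡_ _<_) where
  open Alph sto
  open PlacticCongruence sto using (∼-map; ∼-filter)
  open PlacticCommutation sto using (S1·S11↭S11·S1; S1·S2↭S2·S1)

  module _ {c ℓ} (X : Presentation c ℓ) where
    open Presentation X renaming (refl to ≈-refl; sym to ≈-sym; trans to ≈-trans)

    ∼-respecting-commutes : (∀ {u v} → u ∼ v → φ u ≈ φ v) → Cond2 X × Cond2' X
    ∼-respecting-commutes φ-∼ =
      (λ B B! → SetoidPermutationProperties.map⁺ (Monoid.setoid PlacMonoid) setoid φ-∼ (S1·S11↭S11·S1 B!)) ,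
      (λ B B! → SetoidPermutationProperties.map⁺ (Monoid.setoid PlacMonoid) setoid φ-∼ (S1·S2↭S2·S1 B!))

    Plac'⇒Plac : IsPlac' X → IsPlac X
    Plac'⇒Plac (c1 , c2′ , c3 , c4) =
      c1 , proj₁ (∼-respecting-commutes (KnuthRelations.φ-∼-by-S2 sto X c1 c3 c4 c2′)) , c3 , c4

    Plac⇒Plac' : IsPlac X → IsPlac' X
    Plac⇒Plac' (c1 , c2 , c3 , c4) =
      c1 , proj₂ (∼-respecting-commutes (KnuthRelations.φ-∼-by-S11 sto X c1 c3 c4 c2)) , c3 , c4

    IsObj⇒IsPlac : ∀ v → IsObj v X → IsPlac X
    IsObj⇒IsPlac plac  isPlac  = isPlac
    IsObj⇒IsPlac plac' isPlac' = Plac'⇒Plac isPlac'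

    from-Plactic : IsPlac X → Hom Plactic X
    from-Plactic (c1 , c2 , c3 , c4) = record
      { θ      = φ
      ; θ-cong = KnuthRelations.φ-∼-by-S11 sto X c1 c3 c4 c2
      ; θ-ε    = φ-ε
      ; θ-∙    = φ-∙
      ; θ-φ    = λ _ → ≈-refl
      ; θ-ψ    = c1
      }

    from-Plactic-unique : (h h′ : Hom Plactic X) → ∀ m → Hom.θ h m ≈ Hom.θ h′ m
    from-Plactic-unique h h′ m = ≈-trans (Hom.θ-φ h m) (≈-sym (Hom.θ-φ h′ m))

  Plactic-isPlac : IsPlac Plactic
  Plactic-isPlac = (λ _ → ↭-refl) , proj₁ (∼-respecting-commutes Plactic id) , cond3 , cond4
    where
    cond3 : Cond3 Plactic
    cond3 _ _ _ _ _ _ f-mono _ _ w₁⊆B _ w₁∼w₂ = ∼-map f-mono w₁∼w₂ w₁⊆B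
    cond4 : Cond4 Plactic
    cond4 _ I? I-interval _ _ = ∼-filter I? I-interval

  Plactic-isObj : ∀ v → IsObj v Plactic
  Plactic-isObj plac  = Plactic-isPlac
  Plactic-isObj plac' = Plac⇒Plac' Plactic Plactic-isPlac

  Plactic-initial : ∀ v → IsInitial v Plactic
  Plactic-initial v = record
    { isObj  = Plactic-isObj v
    ; arrow  = λ Y isObj → from-Plactic Y (IsObj⇒IsPlac Y v isObj)
    ; unique = λ Y _ → from-Plactic-unique Y
    }

proposition5p1 : ∀ {a r : Level} {A : Set a} {_<_ : Rel A r}
    (sto : IsStrictTotalOrder _≡_ _<_) →
    ((∀ {c ℓ} (X : Alph.Presentation sto c ℓ) →
        (Alph.IsPlac' sto X → Alph.IsPlac sto X) × (Alph.IsPlac sto X → Alph.IsPlac' sto X))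
      ×ω (Alph.IsInitial sto Alph.plac (Alph.Plactic sto)
      ×ω Alph.IsInitial sto Alph.plac' (Alph.Plactic sto)))
proposition5p1 sto = (λ X → Plac'⇒Plac X , Plac⇒Plac' X) ,ω (Plactic-initial plac ,ω Plactic-initial plac')
  where open Alph sto using (plac; plac')
        open Initiality sto
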